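{- Let $(A,\leq,0,1)$ be a finite bounded poset, $(T,R)$ a time frame with reflexive $R$, and $q\in A^T$. Then $q\leq(\varphi\circ P)(q)$, $q\leq(\varphi\circ F)(q)$, $(\varphi\circ H)(q)\leq q$ and $(\varphi\circ G)(q)\leq q$.
   Context: For $B\subseteq A$: $L(B)$, $U(B)$ are the sets of lower and upper bounds of $B$; $\operatorname{Max}B$, $\operatorname{Min}B$ the sets of maximal and minimal elements. A time frame is $(T,R)$ with $T\neq\emptyset$ and $R\subseteq T^2$. Tense operators $A^T\to(2^A\setminus\{\emptyset\})^T$: $P(q)(s)=\operatorname{Min}U(\{q(t)\mid t\mathrel Rs\})$, $F(q)(s)=\operatorname{Min}U(\{q(t)\mid s\mathrel Rt\})$, $H(q)(s)=\operatorname{Max}L(\{q(t)\mid t\mathrel Rs\})$, $G(q)(s)=\operatorname{Max}L(\{q(t)\mid s\mathrel Rt\})$. The transformation function is $\varphi(x)=\{p\in A^T\mid p(t)\in x(t)\text{ for all }t\in T\}$ for $x\in(2^A\setminus\{\emptyset\})^T$. For $p,q\in A^T$, $p\leq q$ means $p(t)\leq q(t)$ for all $t$; for $q\in A^T$ and nonempty $B\subseteq A^T$, $q\leq B$ means $q\leq p$ for all $p\in B$, and $B\leq q$ means $p\leq q$ for all $p\in B$. -}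

module Defs where

open import Level using (Level; _⊔_; Lift)
open import Data.Product using (Σ; ∃; _×_; _,_)
open import Data.Nat using (ℕ)
open import Data.List using (List)
open import Data.List.Membership.Setoid using () renaming (_∈_ to _∈L_)
open import Relation.Binary.Bundles using (Poset)
open import Relation.Binary.Definitions using (Reflexive)

record FiniteBoundedPoset (c ℓ₁ ℓ₂ : Level) : Set (Level.suc (c ⊔ ℓ₁ ⊔ ℓ₂)) where
  field
    poset : Poset c ℓ₁ ℓ₂
  open Poset poset public
  field
    elements : List Carrier
    complete : ∀ x → _∈L_ Eq.setoid x elements
    bot : Carrier
    top : Carrier
    bot-least : ∀ x → bot ≤ x
    top-greatest : ∀ x → x ≤ top

record TimeFrame (t r : Level) : Set (Level.suc (t ⊔ r)) where
  field
    T : Set t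
    inhabitant : T
    R : T → T → Set r

module Tense {c ℓ₁ ℓ₂ t r : Level}
             (𝔸 : FiniteBoundedPoset c ℓ₁ ℓ₂) (𝕋 : TimeFrame t r) where
  open FiniteBoundedPoset 𝔸

  ℓ : Level
  ℓ = c ⊔ ℓ₁ ⊔ ℓ₂ ⊔ t ⊔ r
  open TimeFrame 𝕋

  Subset : Set (Level.suc ℓ)
  Subset = Carrier → Set ℓ

  U : Subset → Subset
  U B x = Lift ℓ (∀ y → B y → y ≤ x)

  L : Subset → Subset
  L B x = Lift ℓ (∀ y → B y → x ≤ y)

  Min : Subset → Subset
  Min B x = B x × Lift ℓ (∀ y → B y → y ≤ x → y ≈ x)

  Max : Subset → Subset
  Max B x = B x × Lift ℓ (∀ y → B y → x ≤ y → x ≈ y)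

  past : (T → Carrier) → T → Subset
  past q s a = Lift ℓ (Σ T λ u → R u s × q u ≈ a)

  future : (T → Carrier) → T → Subset
  future q s a = Lift ℓ (Σ T λ u → R s u × q u ≈ a)

  P F H G : (T → Carrier) → T → Subset
  P q s = Min (U (past q s))
  F q s = Min (U (future q s))
  H q s = Max (L (past q s))
  G q s = Max (L (future q s))

  φ : (T → Subset) → (T → Carrier) → Set ℓ
  φ x p = ∀ s → x s (p s)

  _≤ᵀ_ : (T → Carrier) → (T → Carrier) → Set (ℓ₂ ⊔ t)
  p ≤ᵀ q = ∀ s → p s ≤ q s

  _≤ˢ_ : (T → Carrier) → ((T → Carrier) → Set ℓ) → Set ℓ
  q ≤ˢ B = ∀ p → B p → q ≤ᵀ p

  _ˢ≤_ : ((T → Carrier) → Set ℓ) → (T → Carrier) → Set ℓ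
  B ˢ≤ q = ∀ p → B p → p ≤ᵀ q

-- By reflexivity of R, q(s) itself belongs to both {q(t) | t R s} and {q(t) | s R t}.
-- So every value p(s) of a p ∈ φ(P q), being an upper bound of the first set, lies
-- above q(s); dually every value of a p ∈ φ(H q) is a lower bound, hence below q(s).
module Submission where

open import Defs
open import Level using (Level; lift; lower)
open import Data.Product using (_×_; _,_; proj₁)
open import Relation.Binary.Definitions using (Reflexive)

module _ {c ℓ₁ ℓ₂ t r : Level}
         (𝔸 : FiniteBoundedPoset c ℓ₁ ℓ₂) (𝕋 : TimeFrame t r) where
  open FiniteBoundedPoset 𝔸
  open TimeFrame 𝕋
  open Tense 𝔸 𝕋

  Min-U-upper : ∀ {B x y} → Min (U B) x → B y → y ≤ x
  Min-U-upper x∈ y∈ = lower (proj₁ x∈) _ y∈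

  Max-L-lower : ∀ {B x y} → Max (L B) x → B y → x ≤ y
  Max-L-lower x∈ y∈ = lower (proj₁ x∈) _ y∈

  module _ (R-refl : Reflexive R) (q : T → Carrier) where

    past-self : ∀ s → past q s (q s)
    past-self s = lift (s , R-refl , Eq.refl)

    future-self : ∀ s → future q s (q s)
    future-self s = lift (s , R-refl , Eq.refl)

    ≤ˢ-φ-Min-U : (S : T → Subset) → (∀ s → S s (q s)) →
                 q ≤ˢ φ (λ s → Min (U (S s)))
    ≤ˢ-φ-Min-U S self p p∈ s = Min-U-upper (p∈ s) (self s)

    φ-Max-L-ˢ≤ : (S : T → Subset) → (∀ s → S s (q s)) →
                 φ (λ s → Max (L (S s))) ˢ≤ q
    φ-Max-L-ˢ≤ S self p p∈ s = Max-L-lower (p∈ s) (self s)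

    tense-bounds : (q ≤ˢ φ (P q)) × (q ≤ˢ φ (F q)) × (φ (H q) ˢ≤ q) × (φ (G q) ˢ≤ q)
    tense-bounds =
        ≤ˢ-φ-Min-U (past q) past-self
      , ≤ˢ-φ-Min-U (future q) future-self
      , φ-Max-L-ˢ≤ (past q) past-self
      , φ-Max-L-ˢ≤ (future q) future-self

proposition9 : ∀ {c ℓ₁ ℓ₂ t r : Level}
    (𝔸 : FiniteBoundedPoset c ℓ₁ ℓ₂) (𝕋 : TimeFrame t r) →
    Reflexive (TimeFrame.R 𝕋) →
    (q : TimeFrame.T 𝕋 → FiniteBoundedPoset.Carrier 𝔸) →
    let open Tense 𝔸 𝕋 in
    (q ≤ˢ φ (P q)) × (q ≤ˢ φ (F q)) × (φ (H q) ˢ≤ q) × (φ (G q) ˢ≤ q)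
proposition9 = tense-bounds
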